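{- For any $k \in \mathbb N$, we have \[M(k+1) \ge M(k) + k+2,\qquad M(2k+2)\ge 3M(k) + M(k+1),\qquad M(2k+3)\ge M(k) + 3M(k+1).\]
   Context: A permutation of length $n\ge0$ is a bijection $\pi$ of $[n]$, written as $\pi(1)\ldots\pi(n)$. $\pi$ contains $\tau$ ($\tau$ is a pattern of $\pi$) if $\pi$ has a subsequence in the same relative order as $\tau$; proper if $\tau$ is shorter than $\pi$. $\mathbb N=\{0,1,2,\dots\}$. For $r,s\in\mathbb N$, $\pi$ is $(r,s)$-coverable if its terms can be partitioned into $r$ increasing and $s$ decreasing (possibly empty) subsequences. $D(\pi)=\{(r,s)\in\mathbb N^2:\pi\text{ is not }(r,s)\text{ -coverable}\}$. For $k\in\mathbb N$ let $T(k)=\{(r,s)\in\mathbb N^2: r+s\le k\}$. $\pi$ is $T(k)$-minimal if $D(\pi)=T(k)$ and every proper pattern $\tau$ of $\pi$ is $(r,s)$-coverable for some $(r,s)\in T(k)$ (equivalently: $\pi$ is not $(r,s)$-coverable for any $r+s\le k$, every proper pattern is $(r,s)$-coverable for some $r+s=k$, and $\pi$ is $(r,s)$-coverable whenever $r+s=k+1$). $M(k)$ is the supremum (in $\mathbb N\cup\{\infty\}$, with the supremum of the empty set taken to be $0$) of the lengths of $T(k)$-minimal permutations. -}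

module Defs where

open import Data.Nat using (ℕ; zero; suc; _+_; _*_; _≤_; _<_)
open import Data.Fin using (Fin) renaming (_<_ to _<ᶠ_)
open import Data.Sum using (_⊎_; inj₁; inj₂)
open import Data.Product using (Σ; _×_; ∃; ∃-syntax)
open import Relation.Nullary using (¬_)
open import Relation.Binary.PropositionalEquality using (_≡_)
open import Function.Definitions using (Injective)

-- A permutation of length n: a bijection of [n] = Fin n, written π(1)…π(n).
-- (An injective endomap of a finite set is a bijection.)
record Perm (n : ℕ) : Set where
  constructor perm
  field
    fun : Fin n → Fin n
    inj : Injective _≡_ _≡_ fun
open Perm public

Contains : ∀ {n m} → Perm n → Perm m → Set
Contains {n} {m} π τ =
  Σ (Fin m → Fin n) λ e →
    (∀ i j → i <ᶠ j → e i <ᶠ e j) ×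
    (∀ i j → (fun τ i <ᶠ fun τ j → fun π (e i) <ᶠ fun π (e j)) ×
             (fun π (e i) <ᶠ fun π (e j) → fun τ i <ᶠ fun τ j))

Coverable : ∀ {n} → ℕ → ℕ → Perm n → Set
Coverable {n} r s π =
  Σ (Fin n → Fin r ⊎ Fin s) λ c →
    (∀ i j (a : Fin r) → c i ≡ inj₁ a → c j ≡ inj₁ a → i <ᶠ j → fun π i <ᶠ fun π j) ×
    (∀ i j (b : Fin s) → c i ≡ inj₂ b → c j ≡ inj₂ b → i <ᶠ j → fun π j <ᶠ fun π i)

InT : ℕ → ℕ → ℕ → Set
InT k r s = r + s ≤ k

DisT : ∀ {n} → ℕ → Perm n → Set
DisT k π = ∀ r s → (¬ Coverable r s π → InT k r s) × (InT k r s → ¬ Coverable r s π)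

TMinimal : ∀ {n} → ℕ → Perm n → Set
TMinimal {n} k π =
  DisT k π ×
  (∀ {m} (τ : Perm m) → m < n → Contains π τ →
     ∃[ r ] ∃[ s ] (InT k r s × Coverable r s τ))

-- x ≤ M(k), where M(k) ∈ ℕ ∪ {∞} is the supremum (sup ∅ = 0) of the
-- lengths of T(k)-minimal permutations: either x = 0 or some T(k)-minimal
-- permutation has length ≥ x.
_≤M_ : ℕ → ℕ → Set
x ≤M k = (x ≡ 0) ⊎ (∃[ n ] (x ≤ n × Σ (Perm n) (TMinimal k)))

{-# OPTIONS --safe #-}
-- A permutation is T(k)-minimal exactly when it is (r,s)-coverable iff k < r + s, and deleting any
-- one point leaves a permutation that is (r,s)-coverable for some r + s ≤ k.  A covering of a direct
-- sum α ⊕ β may use the same increasing colours on α and on β but needs disjoint decreasing ones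
-- (dually for the skew sum α ⊖ β), so both properties of a sum can be read off its summands.  With
-- δ(n) the decreasing permutation of length n, A a T(k)-minimal and R a T(k+1)-minimal permutation,
-- this makes A ⊕ δ(k+2), (A ⊕ A) ⊖ (A ⊕ R) and (A ⊕ R) ⊖ (R ⊕ R) minimal for T(k+1), T(2k+2) and
-- T(2k+3) respectively; their lengths give the three inequalities.
module Submission where

open import Defs
open import Data.Nat as ℕ using (ℕ; zero; suc; _+_; _*_; _∸_; _≤_; _<_; z≤n; s≤s; _≤?_)
open import Data.Nat.Properties as ℕ using (module ≤-Reasoning)
open import Data.Nat.Tactic.RingSolver using (solve)
open import Data.Fin as Fin using (Fin; zero; suc; toℕ; _↑ˡ_; _↑ʳ_; opposite; punchIn; punchOut)
  renaming (_<_ to _<ᶠ_)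
open import Data.Fin.Properties as Fin using ()
open import Data.List using (_∷_; [])
import Data.Vec.Functional as Vector
open import Data.Maybe as Maybe using (Maybe; just; nothing)
open import Data.Maybe.Properties using (just-injective)
import Data.Maybe.Properties as Maybe
import Data.Sum.Properties as Sum
open import Data.Product using (Σ; ∃; ∃₂; _×_; _,_; proj₁; proj₂)
open import Data.Sum as Sum using (_⊎_; inj₁; inj₂)
open import Data.Sum.Properties using (inj₁-injective; inj₂-injective)
open import Data.Empty using (⊥; ⊥-elim)
open import Function using (_∘_; id)
open import Relation.Nullary using (¬_; ¬?; Dec; yes; no; contradiction)
open import Relation.Nullary.Decidable using (_×-dec_; _→-dec_; decidable-stable)
open import Relation.Unary using (Decidable; _⊆_; ∅)
open import Relation.Binary using (tri<; tri≈; tri>)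
open import Relation.Binary.PropositionalEquality
  using (_≡_; _≢_; refl; sym; trans; cong; subst; subst₂)

private
  variable
    n m r s k : ℕ

-- Direct and skew sums

data Split (n m : ℕ) : Fin (n + m) → Set where
  left  : (i : Fin n) → Split n m (i ↑ˡ m)
  right : (j : Fin m) → Split n m (n ↑ʳ j)

split : ∀ n m (x : Fin (n + m)) → Split n m x
split zero    m x       = right x
split (suc n) m zero    = left zero
split (suc n) m (suc x) with split n m x
... | left i  = left (suc i)
... | right j = right j

split-↑ˡ : ∀ n m (i : Fin n) → split n m (i ↑ˡ m) ≡ left i
split-↑ˡ (suc n) m zero    = refl
split-↑ˡ (suc n) m (suc i) rewrite split-↑ˡ n m i = refl

split-↑ʳ : ∀ n m (j : Fin m) → split n m (n ↑ʳ j) ≡ right j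
split-↑ʳ zero    m j = refl
split-↑ʳ (suc n) m j rewrite split-↑ʳ n m j = refl

↑ˡ<↑ʳ : (i : Fin n) (j : Fin m) → i ↑ˡ m <ᶠ n ↑ʳ j
↑ˡ<↑ʳ {n} {m} i j = subst₂ _<_ (sym (Fin.toℕ-↑ˡ i m)) (sym (Fin.toℕ-↑ʳ n j))
  (ℕ.<-≤-trans (Fin.toℕ<n i) (ℕ.m≤m+n n (toℕ j)))

↑ˡ-mono-< : {i j : Fin n} → i <ᶠ j → i ↑ˡ m <ᶠ j ↑ˡ m
↑ˡ-mono-< {m = m} {i} {j} = subst₂ _<_ (sym (Fin.toℕ-↑ˡ i m)) (sym (Fin.toℕ-↑ˡ j m))

↑ˡ-cancel-< : {i j : Fin n} → i ↑ˡ m <ᶠ j ↑ˡ m → i <ᶠ j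
↑ˡ-cancel-< {m = m} {i} {j} = subst₂ _<_ (Fin.toℕ-↑ˡ i m) (Fin.toℕ-↑ˡ j m)

↑ʳ-mono-< : {i j : Fin m} → i <ᶠ j → n ↑ʳ i <ᶠ n ↑ʳ j
↑ʳ-mono-< {n = n} {i} {j} i<j = subst₂ _<_ (sym (Fin.toℕ-↑ʳ n i)) (sym (Fin.toℕ-↑ʳ n j))
  (ℕ.+-monoʳ-< n i<j)

↑ʳ-cancel-< : {i j : Fin m} → n ↑ʳ i <ᶠ n ↑ʳ j → i <ᶠ j
↑ʳ-cancel-< {n = n} {i} {j} i<j = ℕ.+-cancelˡ-< n _ _
  (subst₂ _<_ (Fin.toℕ-↑ʳ n i) (Fin.toℕ-↑ʳ n j) i<j)

↑ˡ≢↑ʳ : (i : Fin n) (j : Fin m) → i ↑ˡ m ≢ n ↑ʳ j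
↑ˡ≢↑ʳ i j eq = Fin.<-irrefl eq (↑ˡ<↑ʳ i j)

opposite-anti-< : {i j : Fin n} → i <ᶠ j → opposite j <ᶠ opposite i
opposite-anti-< {suc n} {i} {j} i<j = subst₂ _<_ (sym (Fin.opposite-prop j)) (sym (Fin.opposite-prop i))
  (ℕ.∸-monoʳ-< (s≤s i<j) (Fin.toℕ<n j))

opposite-injective : {i j : Fin n} → opposite i ≡ opposite j → i ≡ j
opposite-injective {i = i} {j} eq =
  trans (sym (Fin.opposite-involutive i)) (trans (cong opposite eq) (Fin.opposite-involutive j))

onSplit : ∀ {a} {A : Set a} → (Fin n → A) → (Fin m → A) → ∀ {x} → Split n m x → A
onSplit f g (left i)  = f i
onSplit f g (right j) = g j

_⊕_ : Perm n → Perm m → Perm (n + m)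
_⊕_ {n} {m} α β = perm (λ x → onSplit value₁ value₂ (split n m x))
                        (λ {x} {y} → injective (split n m x) (split n m y))
  where
  value₁ : Fin n → Fin (n + m)
  value₁ i = fun α i ↑ˡ m
  value₂ : Fin m → Fin (n + m)
  value₂ j = n ↑ʳ fun β j
  injective : ∀ {x y} (vx : Split n m x) (vy : Split n m y) →
              onSplit value₁ value₂ vx ≡ onSplit value₁ value₂ vy → x ≡ y
  injective (left i)  (left i′)  eq = cong (_↑ˡ m) (inj α (Fin.↑ˡ-injective m _ _ eq))
  injective (left i)  (right j′) eq = ⊥-elim (↑ˡ≢↑ʳ _ _ eq)
  injective (right j) (left i′)  eq = ⊥-elim (↑ˡ≢↑ʳ _ _ (sym eq))
  injective (right j) (right j′) eq = cong (n ↑ʳ_) (inj β (Fin.↑ʳ-injective n _ _ eq))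

module _ (α : Perm n) (β : Perm m) where

  ⊕-↑ˡ : ∀ i → fun (α ⊕ β) (i ↑ˡ m) ≡ fun α i ↑ˡ m
  ⊕-↑ˡ i rewrite split-↑ˡ n m i = refl

  ⊕-↑ʳ : ∀ j → fun (α ⊕ β) (n ↑ʳ j) ≡ n ↑ʳ fun β j
  ⊕-↑ʳ j rewrite split-↑ʳ n m j = refl

  ⊕-<ˡ : ∀ {i j} → fun α i <ᶠ fun α j → fun (α ⊕ β) (i ↑ˡ m) <ᶠ fun (α ⊕ β) (j ↑ˡ m)
  ⊕-<ˡ {i} {j} = subst₂ _<ᶠ_ (sym (⊕-↑ˡ i)) (sym (⊕-↑ˡ j)) ∘ ↑ˡ-mono-<

  ⊕-<ʳ : ∀ {i j} → fun β i <ᶠ fun β j → fun (α ⊕ β) (n ↑ʳ i) <ᶠ fun (α ⊕ β) (n ↑ʳ j)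
  ⊕-<ʳ {i} {j} = subst₂ _<ᶠ_ (sym (⊕-↑ʳ i)) (sym (⊕-↑ʳ j)) ∘ ↑ʳ-mono-<

  ⊕-<ˡʳ : ∀ i j → fun (α ⊕ β) (i ↑ˡ m) <ᶠ fun (α ⊕ β) (n ↑ʳ j)
  ⊕-<ˡʳ i j = subst₂ _<ᶠ_ (sym (⊕-↑ˡ i)) (sym (⊕-↑ʳ j)) (↑ˡ<↑ʳ _ _)

  ⊕-containsˡ : Contains (α ⊕ β) α
  ⊕-containsˡ = (_↑ˡ m) , (λ _ _ → ↑ˡ-mono-<) , λ i j →
    ⊕-<ˡ , ↑ˡ-cancel-< ∘ subst₂ _<ᶠ_ (⊕-↑ˡ i) (⊕-↑ˡ j)

  ⊕-containsʳ : Contains (α ⊕ β) β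
  ⊕-containsʳ = (n ↑ʳ_) , (λ _ _ → ↑ʳ-mono-<) , λ i j →
    ⊕-<ʳ , ↑ʳ-cancel-< ∘ subst₂ _<ᶠ_ (⊕-↑ʳ i) (⊕-↑ʳ j)

complement : Perm n → Perm n
complement π = perm (opposite ∘ fun π) (inj π ∘ opposite-injective)

-- Through complements, every statement about ⊖ is one about ⊕ with the roles of increasing and
-- decreasing colours exchanged.
_⊖_ : Perm n → Perm m → Perm (n + m)
α ⊖ β = complement (complement α ⊕ complement β)

identity : ∀ n → Perm n
identity n = perm id id

δ : ∀ n → Perm n
δ n = complement (identity n)

-- Partial colourings

Colour : ℕ → ℕ → Set
Colour r s = Fin r ⊎ Fin s

SameInc : Maybe (Colour r s) → Maybe (Colour r s) → Set
SameInc x y = ∃ λ a → x ≡ just (inj₁ a) × y ≡ just (inj₁ a)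

SameDec : Maybe (Colour r s) → Maybe (Colour r s) → Set
SameDec x y = ∃ λ b → x ≡ just (inj₂ b) × y ≡ just (inj₂ b)

record CoverableOff (r s : ℕ) (π : Perm n) (Z : Fin n → Set) : Set where
  field
    colour     : Fin n → Maybe (Colour r s)
    increasing : ∀ {i j} → i <ᶠ j → SameInc (colour i) (colour j) → fun π i <ᶠ fun π j
    decreasing : ∀ {i j} → i <ᶠ j → SameDec (colour i) (colour j) → fun π j <ᶠ fun π i
    uncoloured : ∀ x → colour x ≡ nothing → Z x
open CoverableOff

private
  variable
    π σ : Perm n
    Z Z′ : Fin n → Set

coverable⇒coverableOff : Coverable r s π → CoverableOff r s π Z
coverable⇒coverableOff (c , inc , dec) = record
  { colour     = just ∘ c
  ; increasing = λ i<j (a , eq₁ , eq₂) → inc _ _ a (just-injective eq₁) (just-injective eq₂) i<j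
  ; decreasing = λ i<j (b , eq₁ , eq₂) → dec _ _ b (just-injective eq₁) (just-injective eq₂) i<j
  ; uncoloured = λ _ ()
  }

fromJust : ∀ {A : Set} (x : Maybe A) → x ≢ nothing → A
fromJust (just a) _  = a
fromJust nothing  ¬n = ⊥-elim (¬n refl)

fromJust-≡ : ∀ {A : Set} (x : Maybe A) (¬n : x ≢ nothing) → x ≡ just (fromJust x ¬n)
fromJust-≡ (just a) _  = refl
fromJust-≡ nothing  ¬n = ⊥-elim (¬n refl)

coverableOff⇒coverable : CoverableOff r s π Z → (∀ x → ¬ Z x) → Coverable r s π
coverableOff⇒coverable cv noHole =
  (λ x → fromJust (colour cv x) (coloured x)) ,
  (λ i j a eq₁ eq₂ i<j → increasing cv i<j (a , colour-≡ i eq₁ , colour-≡ j eq₂)) ,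
  (λ i j b eq₁ eq₂ i<j → decreasing cv i<j (b , colour-≡ i eq₁ , colour-≡ j eq₂))
  where
  coloured : ∀ x → colour cv x ≢ nothing
  coloured x = noHole x ∘ uncoloured cv x
  colour-≡ : ∀ x {c} → fromJust (colour cv x) (coloured x) ≡ c → colour cv x ≡ just c
  colour-≡ x eq = trans (fromJust-≡ (colour cv x) (coloured x)) (cong just eq)

coverableOff-⊆ : Z ⊆ Z′ → CoverableOff r s π Z → CoverableOff r s π Z′
coverableOff-⊆ Z⊆Z′ cv = record
  { colour     = colour cv
  ; increasing = increasing cv
  ; decreasing = decreasing cv
  ; uncoloured = λ x → Z⊆Z′ ∘ uncoloured cv x
  }

coverableOff-cong : (∀ i → fun π i ≡ fun σ i) → CoverableOff r s π Z → CoverableOff r s σ Z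
coverableOff-cong π≗σ cv = record
  { colour     = colour cv
  ; increasing = λ i<j → subst₂ _<ᶠ_ (π≗σ _) (π≗σ _) ∘ increasing cv i<j
  ; decreasing = λ i<j → subst₂ _<ᶠ_ (π≗σ _) (π≗σ _) ∘ decreasing cv i<j
  ; uncoloured = uncoloured cv
  }

restrict : ∀ {σ : Perm n} {τ : Perm m} {Z : Fin n → Set} (τ⊆σ : Contains σ τ) →
           CoverableOff r s σ Z → CoverableOff r s τ (Z ∘ proj₁ τ⊆σ)
restrict (e , e-mono , e-order) cv = record
  { colour     = colour cv ∘ e
  ; increasing = λ {i} {j} i<j → proj₂ (e-order i j) ∘ increasing cv (e-mono i j i<j)
  ; decreasing = λ {i} {j} i<j → proj₂ (e-order j i) ∘ decreasing cv (e-mono i j i<j)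
  ; uncoloured = uncoloured cv ∘ e
  }

recolour : ∀ {r′ s′} (cv : CoverableOff r s π Z) (c : Fin n → Maybe (Colour r′ s′)) →
           (∀ {i j} → SameInc (c i) (c j) → SameInc (colour cv i) (colour cv j)) →
           (∀ {i j} → SameDec (c i) (c j) → SameDec (colour cv i) (colour cv j)) →
           (∀ x → c x ≡ nothing → colour cv x ≡ nothing) →
           CoverableOff r′ s′ π Z
recolour cv c sameInc sameDec none = record
  { colour     = c
  ; increasing = λ i<j → increasing cv i<j ∘ sameInc
  ; decreasing = λ i<j → decreasing cv i<j ∘ sameDec
  ; uncoloured = λ x → uncoloured cv x ∘ none x
  }

mapColour : ∀ {r′ s′} → (Fin r → Fin r′) → (Fin s → Fin s′) →
            Maybe (Colour r s) → Maybe (Colour r′ s′)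
mapColour f g = Maybe.map (Sum.map f g)

module _ {r′ s′} {f : Fin r → Fin r′} {g : Fin s → Fin s′} where

  mapColour-sameInc : (∀ {a a′} → f a ≡ f a′ → a ≡ a′) →
                      ∀ x y → SameInc (mapColour f g x) (mapColour f g y) → SameInc x y
  mapColour-sameInc f-inj (just (inj₁ a)) (just (inj₁ a′)) (_ , refl , eq) =
    a , refl , cong (just ∘ inj₁) (f-inj (inj₁-injective (just-injective eq)))
  mapColour-sameInc _ nothing         _               (_ , () , _)
  mapColour-sameInc _ (just (inj₂ _)) _               (_ , () , _)
  mapColour-sameInc _ (just (inj₁ _)) nothing         (_ , _ , ())
  mapColour-sameInc _ (just (inj₁ _)) (just (inj₂ _)) (_ , _ , ())

  mapColour-sameDec : (∀ {b b′} → g b ≡ g b′ → b ≡ b′) →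
                      ∀ x y → SameDec (mapColour f g x) (mapColour f g y) → SameDec x y
  mapColour-sameDec g-inj (just (inj₂ b)) (just (inj₂ b′)) (_ , refl , eq) =
    b , refl , cong (just ∘ inj₂) (g-inj (inj₂-injective (just-injective eq)))
  mapColour-sameDec _ nothing         _               (_ , () , _)
  mapColour-sameDec _ (just (inj₁ _)) _               (_ , () , _)
  mapColour-sameDec _ (just (inj₂ _)) nothing         (_ , _ , ())
  mapColour-sameDec _ (just (inj₂ _)) (just (inj₁ _)) (_ , _ , ())

  mapColour-nothing : ∀ x → mapColour f g x ≡ nothing → x ≡ nothing
  mapColour-nothing nothing _ = refl

  recolourBy : (∀ {a a′} → f a ≡ f a′ → a ≡ a′) → (∀ {b b′} → g b ≡ g b′ → b ≡ b′) →
               CoverableOff r s π Z → CoverableOff r′ s′ π Z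
  recolourBy f-inj g-inj cv = recolour cv (mapColour f g ∘ colour cv)
    (mapColour-sameInc f-inj _ _) (mapColour-sameDec g-inj _ _) (λ x → mapColour-nothing (colour cv x))

coverableOff-mono : ∀ {r′ s′} → r ≤ r′ → s ≤ s′ → CoverableOff r s π Z → CoverableOff r′ s′ π Z
coverableOff-mono r≤r′ s≤s′ =
  recolourBy (Fin.inject≤-injective r≤r′ r≤r′ _ _) (Fin.inject≤-injective s≤s′ s≤s′ _ _)

swapColour : Maybe (Colour r s) → Maybe (Colour s r)
swapColour = Maybe.map Sum.swap

swap-sameInc : ∀ (x y : Maybe (Colour r s)) → SameInc (swapColour x) (swapColour y) → SameDec x y
swap-sameInc (just (inj₂ b)) (just (inj₂ b′)) (_ , refl , eq) =
  b , refl , cong (just ∘ inj₂) (inj₁-injective (just-injective eq))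
swap-sameInc nothing         _               (_ , () , _)
swap-sameInc (just (inj₁ _)) _               (_ , () , _)
swap-sameInc (just (inj₂ _)) nothing         (_ , _ , ())
swap-sameInc (just (inj₂ _)) (just (inj₁ _)) (_ , _ , ())

swap-sameDec : ∀ (x y : Maybe (Colour r s)) → SameDec (swapColour x) (swapColour y) → SameInc x y
swap-sameDec (just (inj₁ a)) (just (inj₁ a′)) (_ , refl , eq) =
  a , refl , cong (just ∘ inj₁) (inj₂-injective (just-injective eq))
swap-sameDec nothing         _               (_ , () , _)
swap-sameDec (just (inj₂ _)) _               (_ , () , _)
swap-sameDec (just (inj₁ _)) nothing         (_ , _ , ())
swap-sameDec (just (inj₁ _)) (just (inj₂ _)) (_ , _ , ())

swap-nothing : ∀ (x : Maybe (Colour r s)) → swapColour x ≡ nothing → x ≡ nothing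
swap-nothing nothing _ = refl

complement-coverableOff : CoverableOff r s π Z → CoverableOff s r (complement π) Z
complement-coverableOff cv = record
  { colour     = swapColour ∘ colour cv
  ; increasing = λ i<j → opposite-anti-< ∘ decreasing cv i<j ∘ swap-sameInc _ _
  ; decreasing = λ i<j → opposite-anti-< ∘ increasing cv i<j ∘ swap-sameDec _ _
  ; uncoloured = λ x → uncoloured cv x ∘ swap-nothing (colour cv x)
  }

coverableOff-complement : CoverableOff s r (complement π) Z → CoverableOff r s π Z
coverableOff-complement {π = π} =
  coverableOff-cong (λ i → Fin.opposite-involutive (fun π i)) ∘ complement-coverableOff

count : {P : Fin s → Set} → Decidable P → ℕ
count {zero}  P? = 0
count {suc s} P? with P? zero
... | yes _ = suc (count (P? ∘ suc))
... | no  _ = count (P? ∘ suc)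

rank : {P : Fin s → Set} (P? : Decidable P) (x : Fin s) → P x → Fin (count P?)
rank {suc s} P? zero    p with P? zero
... | yes _  = zero
... | no  ¬p = contradiction p ¬p
rank {suc s} P? (suc x) p with P? zero
... | yes _ = suc (rank (P? ∘ suc) x p)
... | no  _ = rank (P? ∘ suc) x p

rank-injective : {P : Fin s → Set} (P? : Decidable P) {x y : Fin s} (p : P x) (q : P y) →
                 rank P? x p ≡ rank P? y q → x ≡ y
rank-injective {suc s} P? {zero}  {zero}  p q eq = refl
rank-injective {suc s} P? {zero}  {suc y} p q eq with P? zero
... | yes _  = ⊥-elim (Fin.0≢1+n eq)
... | no  ¬p = contradiction p ¬p
rank-injective {suc s} P? {suc x} {zero}  p q eq with P? zero
... | yes _  = ⊥-elim (Fin.0≢1+n (sym eq))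
... | no  ¬q = contradiction q ¬q
rank-injective {suc s} P? {suc x} {suc y} p q eq with P? zero
... | yes _ = cong suc (rank-injective (P? ∘ suc) p q (Fin.suc-injective eq))
... | no  _ = cong suc (rank-injective (P? ∘ suc) p q eq)

count-disjoint : {P Q : Fin s → Set} (P? : Decidable P) (Q? : Decidable Q) →
                 (∀ x → P x → Q x → ⊥) → count P? + count Q? ≤ s
count-disjoint {zero}  P? Q? _ = z≤n
count-disjoint {suc s} P? Q? disjoint
  with P? zero | Q? zero | count-disjoint (P? ∘ suc) (Q? ∘ suc) (disjoint ∘ suc)
... | yes p | yes q | _    = ⊥-elim (disjoint zero p q)
... | yes _ | no  _ | rest = s≤s rest
... | no  _ | yes _ | rest = subst (_≤ suc s) (sym (ℕ.+-suc _ _)) (s≤s rest)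
... | no  _ | no  _ | rest = ℕ.m≤n⇒m≤1+n rest

UsesDec : (Fin n → Maybe (Colour r s)) → Fin s → Set
UsesDec c b = ∃ λ i → c i ≡ just (inj₂ b)

usesDec? : (c : Fin n → Maybe (Colour r s)) → Decidable (UsesDec c)
usesDec? c b = Fin.any? λ i → Maybe.≡-dec (Sum.≡-dec Fin._≟_ Fin._≟_) (c i) (just (inj₂ b))

module _ {r : ℕ} {P : Fin s → Set} (P? : Decidable P) where

  DecColourIn : Maybe (Colour r s) → Set
  DecColourIn x = ∀ {b} → x ≡ just (inj₂ b) → P b

  rankDec : (x : Maybe (Colour r s)) → DecColourIn x → Maybe (Colour r (count P?))
  rankDec nothing         _ = nothing
  rankDec (just (inj₁ a)) _ = just (inj₁ a)
  rankDec (just (inj₂ b)) p = just (inj₂ (rank P? b (p refl)))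

  rankDec-sameInc : ∀ x y (px : DecColourIn x) (py : DecColourIn y) →
                    SameInc (rankDec x px) (rankDec y py) → SameInc x y
  rankDec-sameInc (just (inj₁ a)) (just (inj₁ .a)) _ _ (_ , refl , refl) = a , refl , refl
  rankDec-sameInc nothing         _               _ _ (_ , () , _)
  rankDec-sameInc (just (inj₂ _)) _               _ _ (_ , () , _)
  rankDec-sameInc (just (inj₁ _)) nothing         _ _ (_ , _ , ())
  rankDec-sameInc (just (inj₁ _)) (just (inj₂ _)) _ _ (_ , _ , ())

  rankDec-sameDec : ∀ x y (px : DecColourIn x) (py : DecColourIn y) →
                    SameDec (rankDec x px) (rankDec y py) → SameDec x y
  rankDec-sameDec (just (inj₂ b)) (just (inj₂ b′)) px py (_ , refl , eq) =
    b , refl , cong (just ∘ inj₂) (rank-injective P? (py refl) (px refl) (inj₂-injective (just-injective eq)))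
  rankDec-sameDec nothing         _               _ _ (_ , () , _)
  rankDec-sameDec (just (inj₁ _)) _               _ _ (_ , () , _)
  rankDec-sameDec (just (inj₂ _)) nothing         _ _ (_ , _ , ())
  rankDec-sameDec (just (inj₂ _)) (just (inj₁ _)) _ _ (_ , _ , ())

  rankDec-nothing : ∀ x (px : DecColourIn x) → rankDec x px ≡ nothing → x ≡ nothing
  rankDec-nothing nothing         _ _  = refl
  rankDec-nothing (just (inj₁ _)) _ ()
  rankDec-nothing (just (inj₂ _)) _ ()

shrinkDec : (cv : CoverableOff r s π Z) → CoverableOff r (count (usesDec? (colour cv))) π Z
shrinkDec cv = recolour cv (λ i → rankDec U? (colour cv i) (i ,_))
  (rankDec-sameInc U? _ _ _ _) (rankDec-sameDec U? _ _ _ _) (λ x → rankDec-nothing U? (colour cv x) _)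
  where U? = usesDec? (colour cv)

_⊞_ : (Fin n → Set) → (Fin m → Set) → Fin (n + m) → Set
_⊞_ {n} {m} Za Zb x = onSplit Za Zb (split n m x)

⊞-⊆ : {Za : Fin n → Set} {Zb : Fin m → Set} {P : Fin (n + m) → Set} →
      Za ⊆ P ∘ (_↑ˡ m) → Zb ⊆ P ∘ (n ↑ʳ_) → Za ⊞ Zb ⊆ P
⊞-⊆ {n} {m} {Za} {Zb} {P} ⊆ˡ ⊆ʳ {x} = go (split n m x)
  where
  go : ∀ {x} (v : Split n m x) → onSplit Za Zb v → P x
  go (left i)  = ⊆ˡ
  go (right j) = ⊆ʳ

∅⊞∅⊆∅ : ∀ {n m} → _⊞_ {n} {m} ∅ ∅ ⊆ ∅
∅⊞∅⊆∅ {n} {m} = ⊞-⊆ {n} {m} {∅} {∅} {∅} id id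

⊞-≡ˡ : ∀ {n m} (i : Fin n) → _⊞_ {n} {m} (_≡ i) ∅ ⊆ (_≡ i ↑ˡ m)
⊞-≡ˡ {n} {m} i = ⊞-⊆ {n} {m} {_≡ i} {∅} {_≡ i ↑ˡ m} (cong (_↑ˡ m)) λ ()

⊞-≡ʳ : ∀ {n m} (j : Fin m) → _⊞_ {n} {m} ∅ (_≡ j) ⊆ (_≡ n ↑ʳ j)
⊞-≡ʳ {n} {m} j = ⊞-⊆ {n} {m} {∅} {_≡ j} {_≡ n ↑ʳ j} (λ ()) (cong (n ↑ʳ_))

palettes-disjoint : ∀ {sa sb} (x : Maybe (Colour r sa)) (y : Maybe (Colour r sb)) →
                    ¬ SameDec (mapColour id (_↑ˡ sb) x) (mapColour id (sa ↑ʳ_) y)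
palettes-disjoint (just (inj₂ b)) (just (inj₂ b′)) (_ , refl , eq) =
  ↑ˡ≢↑ʳ b b′ (sym (inj₂-injective (just-injective eq)))
palettes-disjoint nothing         _               (_ , () , _)
palettes-disjoint (just (inj₁ _)) _               (_ , () , _)
palettes-disjoint (just (inj₂ _)) nothing         (_ , _ , ())
palettes-disjoint (just (inj₂ _)) (just (inj₁ _)) (_ , _ , ())

module _ {α : Perm n} {β : Perm m} {Za : Fin n → Set} {Zb : Fin m → Set} where

  ⊕-glue : (A : CoverableOff r s α Za) (B : CoverableOff r s β Zb) →
           (∀ i j → ¬ SameDec (colour A i) (colour B j)) → CoverableOff r s (α ⊕ β) (Za ⊞ Zb)
  ⊕-glue {r} {s} A B disjoint = record
    { colour     = λ x → colourAt (split n m x)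
    ; increasing = λ {x} {y} → inc (split n m x) (split n m y)
    ; decreasing = λ {x} {y} → dec (split n m x) (split n m y)
    ; uncoloured = λ x → hole (split n m x)
    }
    where
    colourAt : ∀ {x} → Split n m x → Maybe (Colour r s)
    colourAt = onSplit (colour A) (colour B)
    inc : ∀ {x y} (vx : Split n m x) (vy : Split n m y) → x <ᶠ y →
          SameInc (colourAt vx) (colourAt vy) → fun (α ⊕ β) x <ᶠ fun (α ⊕ β) y
    inc (left i)  (left j)  x<y same = ⊕-<ˡ α β (increasing A (↑ˡ-cancel-< x<y) same)
    inc (left i)  (right j) _   _    = ⊕-<ˡʳ α β i j
    inc (right i) (left j)  x<y _    = ⊥-elim (Fin.<-asym x<y (↑ˡ<↑ʳ j i))
    inc (right i) (right j) x<y same = ⊕-<ʳ α β (increasing B (↑ʳ-cancel-< x<y) same)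
    dec : ∀ {x y} (vx : Split n m x) (vy : Split n m y) → x <ᶠ y →
          SameDec (colourAt vx) (colourAt vy) → fun (α ⊕ β) y <ᶠ fun (α ⊕ β) x
    dec (left i)  (left j)  x<y same = ⊕-<ˡ α β (decreasing A (↑ˡ-cancel-< x<y) same)
    dec (left i)  (right j) _   same = ⊥-elim (disjoint i j same)
    dec (right i) (left j)  x<y _    = ⊥-elim (Fin.<-asym x<y (↑ˡ<↑ʳ j i))
    dec (right i) (right j) x<y same = ⊕-<ʳ α β (decreasing B (↑ʳ-cancel-< x<y) same)
    hole : ∀ {x} (v : Split n m x) → colourAt v ≡ nothing → onSplit Za Zb v
    hole (left i)  = uncoloured A i
    hole (right j) = uncoloured B j

  ⊕-coverableOff : ∀ {sa sb} → CoverableOff r sa α Za → CoverableOff r sb β Zb →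
                   CoverableOff r (sa + sb) (α ⊕ β) (Za ⊞ Zb)
  ⊕-coverableOff {sa = sa} {sb} A B =
    ⊕-glue (recolourBy id (Fin.↑ˡ-injective sb _ _) A) (recolourBy id (Fin.↑ʳ-injective sa _ _) B)
           (λ i j → palettes-disjoint (colour A i) (colour B j))

module _ {α : Perm n} {β : Perm m} where

  ⊕-split : CoverableOff r s (α ⊕ β) Z → ∃₂ λ sa sb → sa + sb ≤ s ×
            CoverableOff r sa α (Z ∘ (_↑ˡ m)) × CoverableOff r sb β (Z ∘ (n ↑ʳ_))
  ⊕-split cv = _ , _ , count-disjoint (usesDec? (colour A)) (usesDec? (colour B)) disjoint ,
               shrinkDec A , shrinkDec B
    where
    A = restrict (⊕-containsˡ α β) cv
    B = restrict (⊕-containsʳ α β) cv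
    disjoint : ∀ b → UsesDec (colour A) b → UsesDec (colour B) b → ⊥
    disjoint b (i , eq₁) (j , eq₂) =
      Fin.<-asym (⊕-<ˡʳ α β i j) (decreasing cv (↑ˡ<↑ʳ i j) (b , eq₁ , eq₂))

module _ {α : Perm n} {β : Perm m} where

  ⊖-coverableOff : ∀ {ra rb} {Za : Fin n → Set} {Zb : Fin m → Set} →
                   CoverableOff ra s α Za → CoverableOff rb s β Zb →
                   CoverableOff (ra + rb) s (α ⊖ β) (Za ⊞ Zb)
  ⊖-coverableOff A B = complement-coverableOff
    (⊕-coverableOff (complement-coverableOff A) (complement-coverableOff B))

  ⊖-split : CoverableOff r s (α ⊖ β) Z → ∃₂ λ ra rb → ra + rb ≤ r ×
            CoverableOff ra s α (Z ∘ (_↑ˡ m)) × CoverableOff rb s β (Z ∘ (n ↑ʳ_))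
  ⊖-split cv with ⊕-split {α = complement α} {β = complement β} (coverableOff-complement cv)
  ... | ra , rb , ra+rb≤r , A , B = ra , rb , ra+rb≤r , coverableOff-complement A , coverableOff-complement B

module _ {α : Perm n} {β : Perm m} where

  ⊕-coverable : ∀ {sa sb} → sa + sb ≤ s → CoverableOff r sa α ∅ → CoverableOff r sb β ∅ →
                CoverableOff r s (α ⊕ β) ∅
  ⊕-coverable sa+sb≤s A B =
    coverableOff-mono ℕ.≤-refl sa+sb≤s (coverableOff-⊆ (∅⊞∅⊆∅ {n} {m}) (⊕-coverableOff A B))

  ⊖-coverable : ∀ {ra rb} → ra + rb ≤ r → CoverableOff ra s α ∅ → CoverableOff rb s β ∅ →
                CoverableOff r s (α ⊖ β) ∅
  ⊖-coverable ra+rb≤r A B =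
    coverableOff-mono ra+rb≤r ℕ.≤-refl (coverableOff-⊆ (∅⊞∅⊆∅ {n} {m}) (⊖-coverableOff A B))

  ⊕-puncturedˡ : ∀ {sa sb} {i} → sa + sb ≤ s → CoverableOff r sa α (_≡ i) → CoverableOff r sb β ∅ →
                 CoverableOff r s (α ⊕ β) (_≡ i ↑ˡ m)
  ⊕-puncturedˡ {i = i} sa+sb≤s A B = coverableOff-mono ℕ.≤-refl sa+sb≤s (coverableOff-⊆ (⊞-≡ˡ i)
    (⊕-coverableOff A B))

  ⊕-puncturedʳ : ∀ {sa sb} {j} → sa + sb ≤ s → CoverableOff r sa α ∅ → CoverableOff r sb β (_≡ j) →
                 CoverableOff r s (α ⊕ β) (_≡ n ↑ʳ j)
  ⊕-puncturedʳ {j = j} sa+sb≤s A B = coverableOff-mono ℕ.≤-refl sa+sb≤s (coverableOff-⊆ (⊞-≡ʳ j)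
    (⊕-coverableOff A B))

  ⊖-puncturedˡ : ∀ {ra rb} {i} → ra + rb ≤ r → CoverableOff ra s α (_≡ i) → CoverableOff rb s β ∅ →
                 CoverableOff r s (α ⊖ β) (_≡ i ↑ˡ m)
  ⊖-puncturedˡ {i = i} ra+rb≤r A B = coverableOff-mono ra+rb≤r ℕ.≤-refl (coverableOff-⊆ (⊞-≡ˡ i)
    (⊖-coverableOff A B))

  ⊖-puncturedʳ : ∀ {ra rb} {j} → ra + rb ≤ r → CoverableOff ra s α ∅ → CoverableOff rb s β (_≡ j) →
                 CoverableOff r s (α ⊖ β) (_≡ n ↑ʳ j)
  ⊖-puncturedʳ {j = j} ra+rb≤r A B = coverableOff-mono ra+rb≤r ℕ.≤-refl (coverableOff-⊆ (⊞-≡ʳ j)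
    (⊖-coverableOff A B))

module _ {i j k : Fin (suc n)} (i≢j : i ≢ j) (i≢k : i ≢ k) where

  punchOut-mono-< : j <ᶠ k → punchOut i≢j <ᶠ punchOut i≢k
  punchOut-mono-< j<k = Fin.≤∧≢⇒< (Fin.punchOut-mono-≤ i≢j i≢k (ℕ.<⇒≤ j<k))
    (λ eq → Fin.<-irrefl (Fin.punchOut-injective i≢j i≢k eq) j<k)

  punchOut-cancel-< : punchOut i≢j <ᶠ punchOut i≢k → j <ᶠ k
  punchOut-cancel-< po<po = Fin.≤∧≢⇒< (Fin.punchOut-cancel-≤ i≢j i≢k (ℕ.<⇒≤ po<po))
    (λ eq → Fin.<-irrefl (Fin.punchOut-cong i eq) po<po)

punchIn-mono-< : ∀ (i : Fin (suc n)) {j k} → j <ᶠ k → punchIn i j <ᶠ punchIn i k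
punchIn-mono-< i {j} {k} j<k = Fin.≤∧≢⇒< (Fin.punchIn-mono-≤ i j k (ℕ.<⇒≤ j<k))
  (λ eq → Fin.<-irrefl (Fin.punchIn-injective i j k eq) j<k)

module _ (π : Perm (suc n)) (p : Fin (suc n)) where

  private
    value≢ : ∀ j → fun π p ≢ fun π (punchIn p j)
    value≢ j = Fin.punchInᵢ≢i p j ∘ sym ∘ inj π

  delete : Perm n
  delete = perm (λ j → punchOut (value≢ j)) λ {j} {j′} eq →
    Fin.punchIn-injective p j j′ (inj π (Fin.punchOut-injective (value≢ j) (value≢ j′) eq))

  delete-contained : Contains π delete
  delete-contained = punchIn p , (λ _ _ → punchIn-mono-< p) , λ i j →
    punchOut-cancel-< (value≢ i) (value≢ j) , punchOut-mono-< (value≢ i) (value≢ j)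

  puncture : Coverable r s delete → CoverableOff r s π (_≡ p)
  puncture {r} {s} (c , inc , dec) = record
    { colour     = λ x → colourAt (p Fin.≟ x)
    ; increasing = λ {i} {j} → increasing′ (p Fin.≟ i) (p Fin.≟ j)
    ; decreasing = λ {i} {j} → decreasing′ (p Fin.≟ i) (p Fin.≟ j)
    ; uncoloured = λ x → uncoloured′ (p Fin.≟ x)
    }
    where
    colourAt : ∀ {x} → Dec (p ≡ x) → Maybe (Colour r s)
    colourAt (yes _)   = nothing
    colourAt (no p≢x) = just (c (punchOut p≢x))
    restore : ∀ {i j} (p≢i : p ≢ i) (p≢j : p ≢ j) →
              fun delete (punchOut p≢i) <ᶠ fun delete (punchOut p≢j) → fun π i <ᶠ fun π j
    restore p≢i p≢j =
      subst₂ _<ᶠ_ (cong (fun π) (Fin.punchIn-punchOut p≢i)) (cong (fun π) (Fin.punchIn-punchOut p≢j))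
      ∘ punchOut-cancel-< (value≢ _) (value≢ _)
    increasing′ : ∀ {i j} (di : Dec (p ≡ i)) (dj : Dec (p ≡ j)) → i <ᶠ j →
                  SameInc (colourAt di) (colourAt dj) → fun π i <ᶠ fun π j
    increasing′ (no p≢i) (no p≢j) i<j (a , eq₁ , eq₂) =
      restore p≢i p≢j (inc _ _ a (just-injective eq₁) (just-injective eq₂) (punchOut-mono-< p≢i p≢j i<j))
    increasing′ (yes _)  _       _ (_ , () , _)
    increasing′ (no _)   (yes _) _ (_ , _ , ())
    decreasing′ : ∀ {i j} (di : Dec (p ≡ i)) (dj : Dec (p ≡ j)) → i <ᶠ j →
                  SameDec (colourAt di) (colourAt dj) → fun π j <ᶠ fun π i
    decreasing′ (no p≢i) (no p≢j) i<j (b , eq₁ , eq₂) =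
      restore p≢j p≢i (dec _ _ b (just-injective eq₁) (just-injective eq₂) (punchOut-mono-< p≢i p≢j i<j))
    decreasing′ (yes _)  _       _ (_ , () , _)
    decreasing′ (no _)   (yes _) _ (_ , _ , ())
    uncoloured′ : ∀ {x} (dx : Dec (p ≡ x)) → colourAt dx ≡ nothing → x ≡ p
    uncoloured′ (yes p≡x) _ = sym p≡x
    uncoloured′ (no _)    ()

singletons : (π : Perm n) → Coverable n 0 π
singletons π = inj₁ ,
  (λ i j a eq₁ eq₂ → ⊥-elim ∘ Fin.<-irrefl (trans (inj₁-injective eq₁) (sym (inj₁-injective eq₂)))) ,
  (λ _ _ ())

singletons-off : (π : Perm (suc n)) (p : Fin (suc n)) → CoverableOff n 0 π (_≡ p)
singletons-off π p = puncture π p (singletons (delete π p))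

δ-decreasing : CoverableOff r 1 (δ n) Z
δ-decreasing = coverable⇒coverableOff ((λ _ → inj₂ zero) , (λ _ _ _ ()) , (λ _ _ _ _ _ → opposite-anti-<))

δ-needs : Coverable r 0 (δ n) → n ≤ r
δ-needs {r} (c , inc , _) = Fin.injective⇒≤ injective
  where
  incColour : Fin r ⊎ Fin 0 → Fin r
  incColour (inj₁ a) = a
  c-≡ : ∀ i → c i ≡ inj₁ (incColour (c i))
  c-≡ i with c i
  ... | inj₁ a = refl
  ordered : ∀ {i j} → i <ᶠ j → incColour (c i) ≢ incColour (c j)
  ordered {i} {j} i<j eq =
    Fin.<-asym (opposite-anti-< i<j) (inc i j _ (c-≡ i) (trans (c-≡ j) (cong inj₁ (sym eq))) i<j)
  injective : ∀ {i j} → incColour (c i) ≡ incColour (c j) → i ≡ j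
  injective {i} {j} eq with Fin.<-cmp i j
  ... | tri< i<j _ _ = ⊥-elim (ordered i<j eq)
  ... | tri≈ _ i≡j _ = i≡j
  ... | tri> _ _ j<i = ⊥-elim (ordered j<i (sym eq))

Searchable : Set → Set₁
Searchable A = ∀ {Q : A → Set} → Decidable Q → Dec (∃ Q)

function-searchable : ∀ {A : Set} → Searchable A → {P : (Fin n → A) → Set} →
                      (∀ {f g} → (∀ x → f x ≡ g x) → P f → P g) → Decidable P → Dec (∃ P)
function-searchable {zero} search {P} resp P? with P? (λ ())
... | yes p  = yes (_ , p)
... | no ¬p = no λ (f , pf) → ¬p (resp (λ ()) pf)
function-searchable {suc n} search {P} resp P?
  with search (λ a → function-searchable search (resp ∘ ∷-cong) (P? ∘ (a Vector.∷_)))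
  where
  ∷-cong : ∀ {a f g} → (∀ x → f x ≡ g x) → ∀ x → (a Vector.∷ f) x ≡ (a Vector.∷ g) x
  ∷-cong f≗g zero    = refl
  ∷-cong f≗g (suc x) = f≗g x
... | yes (a , f , pf) = yes (a Vector.∷ f , pf)
... | no ¬p = no λ (f , pf) → ¬p (Vector.head f , Vector.tail f , resp (λ { zero → refl ; (suc x) → refl }) pf)

colour-searchable : Searchable (Colour r s)
colour-searchable Q? with Fin.any? (Q? ∘ inj₁) | Fin.any? (Q? ∘ inj₂)
... | yes (a , q) | _          = yes (inj₁ a , q)
... | no _        | yes (b , q) = yes (inj₂ b , q)
... | no ¬inc     | no ¬dec     = no λ { (inj₁ a , q) → ¬inc (a , q) ; (inj₂ b , q) → ¬dec (b , q) }

MonotoneClasses : (π : Perm n) → (Fin n → Colour r s) → Set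
MonotoneClasses {r = r} {s} π c =
  (∀ i j (a : Fin r) → c i ≡ inj₁ a → c j ≡ inj₁ a → i <ᶠ j → fun π i <ᶠ fun π j) ×
  (∀ i j (b : Fin s) → c i ≡ inj₂ b → c j ≡ inj₂ b → i <ᶠ j → fun π j <ᶠ fun π i)

coverable? : ∀ r s (π : Perm n) → Dec (Coverable r s π)
coverable? r s π = function-searchable colour-searchable resp λ c →
  Fin.all? (λ i → Fin.all? λ j → Fin.all? λ a →
    (c i ≟ inj₁ a) →-dec (c j ≟ inj₁ a) →-dec (i Fin.<? j) →-dec (fun π i Fin.<? fun π j))
  ×-dec
  Fin.all? (λ i → Fin.all? λ j → Fin.all? λ b →
    (c i ≟ inj₂ b) →-dec (c j ≟ inj₂ b) →-dec (i Fin.<? j) →-dec (fun π j Fin.<? fun π i))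
  where
  _≟_ = Sum.≡-dec Fin._≟_ Fin._≟_
  resp : ∀ {c c′} → (∀ x → c x ≡ c′ x) → MonotoneClasses π c → MonotoneClasses π c′
  resp c≗c′ (inc , dec) = (λ i j a eq₁ eq₂ → inc i j a (trans (c≗c′ i) eq₁) (trans (c≗c′ j) eq₂)) ,
                          (λ i j b eq₁ eq₂ → dec i j b (trans (c≗c′ i) eq₁) (trans (c≗c′ j) eq₂))

record Cutoff (k : ℕ) (π : Perm n) : Set where
  field
    needs  : ∀ {r s} → CoverableOff r s π ∅ → k < r + s
    covers : ∀ r s → k < r + s → CoverableOff r s π ∅
open Cutoff

Punctured : ℕ → Perm n → Set
Punctured {n} k π = ∀ p → ∃₂ λ r s → r + s ≤ k × CoverableOff r s π (_≡ p)

missed-point : (e : Fin m → Fin n) → m < n → ∃ λ p → ∀ i → e i ≢ p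
missed-point e m<n with Fin.any? (λ p → Fin.all? (λ i → ¬? (e i Fin.≟ p)))
... | yes missed  = missed
... | no ¬missed = ⊥-elim (ℕ.<⇒≱ m<n (Fin.injective⇒≤ preimage-injective))
  where
  preimage : ∀ p → ∃ λ i → e i ≡ p
  preimage p with Fin.any? (λ i → e i Fin.≟ p)
  ... | yes hit  = hit
  ... | no ¬hit = ⊥-elim (¬missed (p , λ i eq → ¬hit (i , eq)))
  preimage-injective : ∀ {p q} → proj₁ (preimage p) ≡ proj₁ (preimage q) → p ≡ q
  preimage-injective {p} {q} eq = trans (sym (proj₂ (preimage p))) (trans (cong e eq) (proj₂ (preimage q)))

minimal⇒cutoff : TMinimal k π → Cutoff k π
minimal⇒cutoff {π = π} (D≡T , _) = record
  { needs  = λ {r} {s} cv → ℕ.≰⇒> λ r+s≤k → proj₂ (D≡T r s) r+s≤k (coverableOff⇒coverable cv λ _ ())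
  ; covers = λ r s k<r+s → coverable⇒coverableOff
      (decidable-stable (coverable? r s π) λ ¬cv → ℕ.<⇒≱ k<r+s (proj₁ (D≡T r s) ¬cv))
  }

minimal⇒punctured : ∀ {n k} {π : Perm n} → TMinimal k π → Punctured k π
minimal⇒punctured {n = suc n} {π = π} (_ , patterns) p
  with patterns (delete π p) ℕ.≤-refl (delete-contained π p)
... | r , s , r+s≤k , cv = r , s , r+s≤k , puncture π p cv

cutoff×punctured⇒minimal : Cutoff k π → Punctured k π → TMinimal k π
cutoff×punctured⇒minimal {k = k} {π = π} cut punct = D≡T , patterns
  where
  D≡T : DisT k π
  D≡T r s = (λ ¬cv → ℕ.≮⇒≥ λ k<r+s → ¬cv (coverableOff⇒coverable (covers cut r s k<r+s) λ _ ())) ,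
            (λ r+s≤k cv → ℕ.<⇒≱ (needs cut (coverable⇒coverableOff cv)) r+s≤k)
  patterns : ∀ {m} (τ : Perm m) → m < _ → Contains π τ → ∃₂ λ r s → InT k r s × Coverable r s τ
  patterns τ m<n τ⊆π with missed-point (proj₁ τ⊆π) m<n
  ... | p , missed with punct p
  ... | r , s , r+s≤k , cv = r , s , r+s≤k , coverableOff⇒coverable (restrict {σ = π} {τ = τ} τ⊆π cv) missed

punctured-exact : Punctured k π → ∀ p → ∃₂ λ t u → t + u ≡ k × CoverableOff t u π (_≡ p)
punctured-exact punct p with punct p
... | t , u , t+u≤k , cv with ℕ.m≤n⇒∃[o]m+o≡n t+u≤k
... | d , t+u+d≡k =
  t , u + d , trans (sym (ℕ.+-assoc t u d)) t+u+d≡k , coverableOff-mono ℕ.≤-refl (ℕ.m≤m+n u d) cv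

boundary : ∀ {x r s} → x < r + s → ∃₂ λ r′ s′ → r′ ≤ r × s′ ≤ s × r′ + s′ ≡ suc x
boundary {x} {r} {s} x<r+s with suc x ≤? r
... | yes x<r = suc x , 0 , x<r , z≤n , ℕ.+-identityʳ _
... | no  x≮r = r , suc x ∸ r , ℕ.≤-refl ,
  ℕ.≤-trans (ℕ.∸-monoˡ-≤ r x<r+s) (ℕ.≤-reflexive (ℕ.m+n∸m≡n r s)) , ℕ.m+[n∸m]≡n (ℕ.<⇒≤ (ℕ.≰⇒> x≮r))

covers-from-boundary : (∀ r {s} → r + s ≡ suc k → CoverableOff r s π ∅) →
                       ∀ r s → k < r + s → CoverableOff r s π ∅
covers-from-boundary on-boundary r s k<r+s with boundary k<r+s
... | r′ , s′ , r′≤r , s′≤s , r′+s′≡k+1 =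
  coverableOff-mono r′≤r s′≤s (on-boundary r′ r′+s′≡k+1)

-- The constructions

module _ {π : Perm n} (cut : Cutoff k π) where

  ⊕δ-cutoff : Cutoff (suc k) (π ⊕ δ (suc (suc k)))
  ⊕δ-cutoff = record { needs = needs′ ; covers = covers′ }
    where
    open ≤-Reasoning
    needs′ : CoverableOff r s (π ⊕ δ (suc (suc k))) ∅ → suc k < r + s
    needs′ {r} {s} cv with ⊕-split cv
    ... | _  , zero   , _       , _ , D = ℕ.≤-trans (δ-needs (coverableOff⇒coverable D λ _ ())) (ℕ.m≤m+n r s)
    ... | sa , suc sb , sa+sb≤s , A , _ = begin
      suc (suc k)         ≤⟨ s≤s (needs cut A) ⟩
      suc (r + sa)        ≤⟨ ℕ.m≤m+n _ sb ⟩
      suc (r + sa) + sb   ≡⟨ solve (r ∷ sa ∷ sb ∷ []) ⟩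
      r + (sa + suc sb)   ≤⟨ ℕ.+-monoʳ-≤ r sa+sb≤s ⟩
      r + s               ∎
    covers′ : ∀ r s → suc k < r + s → CoverableOff r s (π ⊕ δ (suc (suc k))) ∅
    covers′ r zero k+1<r = ⊕-coverable ℕ.≤-refl (covers cut r 0 (ℕ.<⇒≤ k+1<r))
      (coverableOff-mono (subst (suc (suc k) ≤_) (ℕ.+-identityʳ r) k+1<r) z≤n
                         (coverable⇒coverableOff (singletons (δ _))))
    covers′ r (suc s) k+1<r+s+1 = ⊕-coverable (ℕ.≤-reflexive (ℕ.+-comm s 1))
      (covers cut r s (ℕ.≤-pred (subst (suc (suc k) ≤_) (ℕ.+-suc r s) k+1<r+s+1)))
      δ-decreasing

  ⊕δ-punctured : Punctured k π → Punctured (suc k) (π ⊕ δ (suc (suc k)))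
  ⊕δ-punctured punct p with split n (suc (suc k)) p
  ... | left i with punct i
  ...   | t , u , t+u≤k , A = t , suc u , ℕ.≤-trans (ℕ.≤-reflexive (ℕ.+-suc t u)) (s≤s t+u≤k) ,
          ⊕-puncturedˡ (ℕ.≤-reflexive (ℕ.+-comm u 1)) A δ-decreasing
  ⊕δ-punctured punct p | right j = suc k , 0 , ℕ.≤-reflexive (ℕ.+-identityʳ _) ,
    ⊕-puncturedʳ ℕ.≤-refl (covers cut (suc k) 0 (ℕ.≤-reflexive (sym (ℕ.+-identityʳ _))))
                          (singletons-off (δ _) j)

+-double-cancel-< : ∀ {m n} → m + m < n + n → m < n
+-double-cancel-< m+m<n+n = ℕ.≰⇒> λ n≤m → ℕ.<⇒≱ m+m<n+n (ℕ.+-mono-≤ n≤m n≤m)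

mutual
  odd-split : ∀ {x} r {s} → r + s ≡ suc (x + x) → ∃₂ λ t u → t + u ≡ x ×
              (r ≡ t + t × s ≡ suc (u + u) ⊎ r ≡ suc (t + t) × s ≡ u + u)
  odd-split zero    {s} eq = 0 , _ , refl , inj₁ (refl , eq)
  odd-split {x} (suc r) eq with even-split {x} r (ℕ.suc-injective eq)
  ... | t , u , inj₁ (t+u≡x , refl , refl) = t , u , t+u≡x , inj₂ (refl , refl)
  ... | t , u , inj₂ (t+u+1≡x , refl , refl) = suc t , u , t+u+1≡x , inj₁ (cong suc (sym (ℕ.+-suc t t)) , refl)

  even-split : ∀ {x} r {s} → r + s ≡ x + x → ∃₂ λ t u →
               (t + u ≡ x × r ≡ t + t × s ≡ u + u) ⊎ (suc (t + u) ≡ x × r ≡ suc (t + t) × s ≡ suc (u + u))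
  even-split zero eq = 0 , _ , inj₁ (refl , refl , eq)
  even-split {zero}  (suc r) ()
  even-split {suc x} (suc r) eq with odd-split {x} r (trans (ℕ.suc-injective eq) (ℕ.+-suc x x))
  ... | t , u , t+u≡x , inj₁ (refl , refl) = t , u , inj₂ (cong suc t+u≡x , refl , refl)
  ... | t , u , t+u≡x , inj₂ (refl , refl) =
    suc t , u , inj₁ (cong suc t+u≡x , cong suc (sym (ℕ.+-suc t t)) , refl)

≡⇒<suc+ : ∀ t u {k} → t + u ≡ k → k < suc t + u
≡⇒<suc+ t u t+u≡k = s≤s (ℕ.≤-reflexive (sym t+u≡k))

≡⇒<+suc : ∀ t u {k} → t + u ≡ k → k < t + suc u
≡⇒<+suc t u t+u≡k = ℕ.≤-reflexive (trans (cong suc (sym t+u≡k)) (sym (ℕ.+-suc t u)))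

module _ {a b : ℕ} {α : Perm n} {β : Perm m} (cutα : Cutoff a α) (cutβ : Cutoff b β) where

  ⊕-needs : CoverableOff r s (α ⊕ β) ∅ → suc a + suc b ≤ (r + r) + s
  ⊕-needs {r} {s} cv with ⊕-split cv
  ... | sa , sb , sa+sb≤s , A , B = begin
    suc a + suc b         ≤⟨ ℕ.+-mono-≤ (needs cutα A) (needs cutβ B) ⟩
    (r + sa) + (r + sb)   ≡⟨ solve (r ∷ sa ∷ sb ∷ []) ⟩
    (r + r) + (sa + sb)   ≤⟨ ℕ.+-monoʳ-≤ (r + r) sa+sb≤s ⟩
    (r + r) + s           ∎
    where open ≤-Reasoning

module _ {a b c d nA nB nC nD : ℕ} {A : Perm nA} {B : Perm nB} {C : Perm nC} {D : Perm nD}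
         (cutA : Cutoff a A) (cutB : Cutoff b B) (cutC : Cutoff c C) (cutD : Cutoff d D) where

  quad-needs : CoverableOff r s ((A ⊕ B) ⊖ (C ⊕ D)) ∅ → (suc a + suc b) + (suc c + suc d) ≤ (r + s) + (r + s)
  quad-needs {r} {s} cv with ⊖-split cv
  ... | r₁ , r₂ , r₁+r₂≤r , AB , CD = begin
    (suc a + suc b) + (suc c + suc d)   ≤⟨ ℕ.+-mono-≤ (⊕-needs cutA cutB AB) (⊕-needs cutC cutD CD) ⟩
    ((r₁ + r₁) + s) + ((r₂ + r₂) + s)   ≡⟨ solve (r₁ ∷ r₂ ∷ s ∷ []) ⟩
    ((r₁ + r₂) + s) + ((r₁ + r₂) + s)   ≤⟨ ℕ.+-mono-≤ r₁+r₂+s≤r+s r₁+r₂+s≤r+s ⟩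
    (r + s) + (r + s)                   ∎
    where
    open ≤-Reasoning
    r₁+r₂+s≤r+s = ℕ.+-monoˡ-≤ s r₁+r₂≤r

module _ {nA nR k : ℕ} {A : Perm nA} {R : Perm nR} (cutA : Cutoff k A) (cutR : Cutoff (suc k) R) where

  private
    fits : ∀ t u {x} → x ≡ suc (suc ((t + u) + (t + u))) → t + u ≡ k → x ≤ suc (suc (k + k))
    fits t u x≡ t+u≡k = ℕ.≤-reflexive (trans x≡ (cong (λ y → suc (suc (y + y))) t+u≡k))
    fits′ : ∀ t u {x} → x ≡ (t + u) + (t + u) → t + u ≡ suc k → x ≤ suc (suc (k + k))
    fits′ t u x≡ t+u≡k+1 =
      ℕ.≤-reflexive (trans x≡ (trans (cong (λ y → y + y) t+u≡k+1) (cong suc (ℕ.+-suc k k))))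

  quad₂-cutoff : Cutoff (suc (suc (k + k))) ((A ⊕ A) ⊖ (A ⊕ R))
  quad₂-cutoff = record { needs = needs′ ; covers = covers′ }
    where
    needs′ : CoverableOff r s ((A ⊕ A) ⊖ (A ⊕ R)) ∅ → suc (suc (k + k)) < r + s
    needs′ {r} {s} cv = +-double-cancel-< (begin
      suc (suc (suc (k + k)) + suc (suc (k + k)))   ≡⟨ solve (k ∷ []) ⟩
      (suc k + suc k) + (suc k + suc (suc k))       ≤⟨ quad-needs cutA cutA cutA cutR cv ⟩
      (r + s) + (r + s)                             ∎)
      where open ≤-Reasoning
    on-boundary : ∀ r {s} → r + s ≡ suc (suc k + suc k) → CoverableOff r s ((A ⊕ A) ⊖ (A ⊕ R)) ∅
    on-boundary r eq with odd-split {suc k} r eq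
    ... | t , u , t+u≡k+1 , inj₁ (refl , refl) = ⊖-coverable ℕ.≤-refl
          (⊕-coverable (ℕ.n≤1+n _) (covers cutA t u k<t+u) (covers cutA t u k<t+u))
          (⊕-coverable (ℕ.≤-reflexive (ℕ.+-suc u u)) (covers cutA t u k<t+u)
                       (covers cutR t (suc u) (≡⇒<+suc t u t+u≡k+1)))
      where k<t+u = ℕ.≤-reflexive (sym t+u≡k+1)
    ... | t , u , t+u≡k+1 , inj₂ (refl , refl) = ⊖-coverable (ℕ.≤-reflexive (ℕ.+-suc t t))
          (⊕-coverable ℕ.≤-refl (covers cutA t u k<t+u) (covers cutA t u k<t+u))
          (⊕-coverable ℕ.≤-refl (covers cutA (suc t) u (ℕ.m<n⇒m<1+n k<t+u))
                                (covers cutR (suc t) u (≡⇒<suc+ t u t+u≡k+1)))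
      where k<t+u = ℕ.≤-reflexive (sym t+u≡k+1)
    covers′ : ∀ r s → suc (suc (k + k)) < r + s → CoverableOff r s ((A ⊕ A) ⊖ (A ⊕ R)) ∅
    covers′ = covers-from-boundary λ r eq → on-boundary r (trans eq (solve (k ∷ [])))

  -- The block containing p gets a punctured covering whose budget (t, u) sums to the level of that
  -- block; every other block gets a budget one above its level.
  quad₂-punctured : Punctured k A → Punctured (suc k) R → Punctured (suc (suc (k + k))) ((A ⊕ A) ⊖ (A ⊕ R))
  quad₂-punctured pA pR p with split (nA + nA) (nA + nR) p
  ... | left x with split nA nA x
  ...   | left i with punctured-exact pA i
  ...     | t , u , t+u≡k , hole = t + suc t , suc (u + u) , fits t u (solve (t ∷ u ∷ [])) t+u≡k ,
    ⊖-puncturedˡ ℕ.≤-refl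
      (⊕-puncturedˡ (ℕ.≤-reflexive (ℕ.+-suc u u)) hole (covers cutA t (suc u) (≡⇒<+suc t u t+u≡k)))
      (⊕-coverable (ℕ.≤-reflexive (ℕ.+-suc u u)) (covers cutA (suc t) u (≡⇒<suc+ t u t+u≡k))
                   (covers cutR (suc t) (suc u) (s≤s (≡⇒<+suc t u t+u≡k))))
  quad₂-punctured pA pR p | left x | right i with punctured-exact pA i
  ...     | t , u , t+u≡k , hole = t + suc t , suc (u + u) , fits t u (solve (t ∷ u ∷ [])) t+u≡k ,
    ⊖-puncturedˡ ℕ.≤-refl
      (⊕-puncturedʳ ℕ.≤-refl (covers cutA t (suc u) (≡⇒<+suc t u t+u≡k)) hole)
      (⊕-coverable (ℕ.≤-reflexive (ℕ.+-suc u u)) (covers cutA (suc t) u (≡⇒<suc+ t u t+u≡k))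
                   (covers cutR (suc t) (suc u) (s≤s (≡⇒<+suc t u t+u≡k))))
  quad₂-punctured pA pR p | right x with split nA nR x
  ...   | left i with punctured-exact pA i
  ...     | t , u , t+u≡k , hole = t + t , suc u + suc u , fits t u (solve (t ∷ u ∷ [])) t+u≡k ,
    ⊖-puncturedʳ ℕ.≤-refl
      (⊕-coverable ℕ.≤-refl (covers cutA t (suc u) (≡⇒<+suc t u t+u≡k))
                            (covers cutA t (suc u) (≡⇒<+suc t u t+u≡k)))
      (⊕-puncturedˡ (ℕ.≤-reflexive (ℕ.+-suc u (suc u))) hole
                    (covers cutR t (suc (suc u)) (≡⇒<+suc t (suc u) (trans (ℕ.+-suc t u) (cong suc t+u≡k)))))
  quad₂-punctured pA pR p | right x | right i with punctured-exact pR i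
  ...     | t , u , t+u≡k+1 , hole = t + t , u + u , fits′ t u (solve (t ∷ u ∷ [])) t+u≡k+1 ,
    ⊖-puncturedʳ ℕ.≤-refl
      (⊕-coverable ℕ.≤-refl (covers cutA t u k<t+u) (covers cutA t u k<t+u))
      (⊕-puncturedʳ ℕ.≤-refl (covers cutA t u k<t+u) hole)
    where k<t+u = ℕ.≤-reflexive (sym t+u≡k+1)

module _ {nA nR k : ℕ} {A : Perm nA} {R : Perm nR} (cutA : Cutoff k A) (cutR : Cutoff (suc k) R) where

  private
    fits : ∀ t u {x} → x ≡ suc (suc (suc ((t + u) + (t + u)))) → t + u ≡ k → x ≤ suc (suc (suc (k + k)))
    fits t u x≡ t+u≡k = ℕ.≤-reflexive (trans x≡ (cong (λ y → suc (suc (suc (y + y)))) t+u≡k))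
    fits′ : ∀ t u {x} → x ≡ suc ((t + u) + (t + u)) → t + u ≡ suc k → x ≤ suc (suc (suc (k + k)))
    fits′ t u x≡ t+u≡k+1 =
      ℕ.≤-reflexive (trans x≡ (trans (cong (λ y → suc (y + y)) t+u≡k+1)
                                     (cong (λ y → suc (suc y)) (ℕ.+-suc k k))))

  quad₃-cutoff : Cutoff (suc (suc (suc (k + k)))) ((A ⊕ R) ⊖ (R ⊕ R))
  quad₃-cutoff = record { needs = needs′ ; covers = covers′ }
    where
    needs′ : CoverableOff r s ((A ⊕ R) ⊖ (R ⊕ R)) ∅ → suc (suc (suc (k + k))) < r + s
    needs′ {r} {s} cv = +-double-cancel-< (begin
      suc (suc (suc (suc (k + k))) + suc (suc (suc (k + k))))   ≡⟨ solve (k ∷ []) ⟩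
      (suc k + suc (suc k)) + (suc (suc k) + suc (suc k))       ≤⟨ quad-needs cutA cutR cutR cutR cv ⟩
      (r + s) + (r + s)                                         ∎)
      where open ≤-Reasoning
    on-boundary : ∀ r {s} → r + s ≡ suc (suc k) + suc (suc k) → CoverableOff r s ((A ⊕ R) ⊖ (R ⊕ R)) ∅
    on-boundary r eq with even-split {suc (suc k)} r eq
    ... | t , u , inj₁ (t+u≡k+2 , refl , refl) = ⊖-coverable ℕ.≤-refl
          (⊕-coverable ℕ.≤-refl (covers cutA t u (ℕ.<⇒≤ k+1<t+u)) (covers cutR t u k+1<t+u))
          (⊕-coverable ℕ.≤-refl (covers cutR t u k+1<t+u) (covers cutR t u k+1<t+u))
      where k+1<t+u = ℕ.≤-reflexive (sym t+u≡k+2)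
    ... | t , u , inj₂ (t+u+1≡k+2 , refl , refl) = ⊖-coverable (ℕ.≤-reflexive (ℕ.+-suc t t))
          (⊕-coverable (ℕ.≤-reflexive (ℕ.+-suc u u)) (covers cutA t u (ℕ.≤-reflexive (sym t+u≡k+1)))
                       (covers cutR t (suc u) (≡⇒<+suc t u t+u≡k+1)))
          (⊕-coverable (ℕ.n≤1+n _) (covers cutR (suc t) u (≡⇒<suc+ t u t+u≡k+1))
                                   (covers cutR (suc t) u (≡⇒<suc+ t u t+u≡k+1)))
      where t+u≡k+1 = ℕ.suc-injective t+u+1≡k+2
    covers′ : ∀ r s → suc (suc (suc (k + k))) < r + s → CoverableOff r s ((A ⊕ R) ⊖ (R ⊕ R)) ∅
    covers′ = covers-from-boundary λ r eq → on-boundary r (trans eq (solve (k ∷ [])))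

  quad₃-punctured : Punctured k A → Punctured (suc k) R → Punctured (suc (suc (suc (k + k)))) ((A ⊕ R) ⊖ (R ⊕ R))
  quad₃-punctured pA pR p with split (nA + nR) (nR + nR) p
  ... | left x with split nA nR x
  ...   | left i with punctured-exact pA i
  ...     | t , u , t+u≡k , hole = t + suc t , suc u + suc u , fits t u (solve (t ∷ u ∷ [])) t+u≡k ,
    ⊖-puncturedˡ ℕ.≤-refl
      (⊕-puncturedˡ (ℕ.≤-reflexive (ℕ.+-suc u (suc u))) hole
                    (covers cutR t (suc (suc u)) (≡⇒<+suc t (suc u) (trans (ℕ.+-suc t u) (cong suc t+u≡k)))))
      (⊕-coverable ℕ.≤-refl (covers cutR (suc t) (suc u) (s≤s (≡⇒<+suc t u t+u≡k)))
                            (covers cutR (suc t) (suc u) (s≤s (≡⇒<+suc t u t+u≡k))))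
  quad₃-punctured pA pR p | left x | right i with punctured-exact pR i
  ...     | t , u , t+u≡k+1 , hole = t + suc t , u + u , fits′ t u (solve (t ∷ u ∷ [])) t+u≡k+1 ,
    ⊖-puncturedˡ ℕ.≤-refl
      (⊕-puncturedʳ ℕ.≤-refl (covers cutA t u (ℕ.≤-reflexive (sym t+u≡k+1))) hole)
      (⊕-coverable ℕ.≤-refl (covers cutR (suc t) u (≡⇒<suc+ t u t+u≡k+1))
                            (covers cutR (suc t) u (≡⇒<suc+ t u t+u≡k+1)))
  quad₃-punctured pA pR p | right x with split nR nR x
  ...   | left i with punctured-exact pR i
  ...     | t , u , t+u≡k+1 , hole = t + t , u + suc u , fits′ t u (solve (t ∷ u ∷ [])) t+u≡k+1 ,
    ⊖-puncturedʳ ℕ.≤-refl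
      (⊕-coverable ℕ.≤-refl (covers cutA t u (ℕ.≤-reflexive (sym t+u≡k+1)))
                            (covers cutR t (suc u) (≡⇒<+suc t u t+u≡k+1)))
      (⊕-puncturedˡ ℕ.≤-refl hole (covers cutR t (suc u) (≡⇒<+suc t u t+u≡k+1)))
  quad₃-punctured pA pR p | right x | right i with punctured-exact pR i
  ...     | t , u , t+u≡k+1 , hole = t + t , u + suc u , fits′ t u (solve (t ∷ u ∷ [])) t+u≡k+1 ,
    ⊖-puncturedʳ ℕ.≤-refl
      (⊕-coverable ℕ.≤-refl (covers cutA t u (ℕ.≤-reflexive (sym t+u≡k+1)))
                            (covers cutR t (suc u) (≡⇒<+suc t u t+u≡k+1)))
      (⊕-puncturedʳ (ℕ.≤-reflexive (sym (ℕ.+-suc u u))) (covers cutR t (suc u) (≡⇒<+suc t u t+u≡k+1)) hole)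

⊕δ-minimal : TMinimal k π → TMinimal (suc k) (π ⊕ δ (suc (suc k)))
⊕δ-minimal {π = π} π-min =
  cutoff×punctured⇒minimal (⊕δ-cutoff cut) (⊕δ-punctured cut (minimal⇒punctured {π = π} π-min))
  where
  cut : Cutoff _ π
  cut = minimal⇒cutoff π-min

module _ {nA nR : ℕ} {A : Perm nA} {R : Perm nR} (A-min : TMinimal k A) (R-min : TMinimal (suc k) R) where

  private
    cutA : Cutoff k A
    cutA = minimal⇒cutoff A-min
    cutR : Cutoff (suc k) R
    cutR = minimal⇒cutoff R-min

  quad₂-minimal : TMinimal (suc (suc (k + k))) ((A ⊕ A) ⊖ (A ⊕ R))
  quad₂-minimal = cutoff×punctured⇒minimal (quad₂-cutoff cutA cutR)
    (quad₂-punctured cutA cutR (minimal⇒punctured {π = A} A-min) (minimal⇒punctured {π = R} R-min))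

  quad₃-minimal : TMinimal (suc (suc (suc (k + k)))) ((A ⊕ R) ⊖ (R ⊕ R))
  quad₃-minimal = cutoff×punctured⇒minimal (quad₃-cutoff cutA cutR)
    (quad₃-punctured cutA cutR (minimal⇒punctured {π = A} A-min) (minimal⇒punctured {π = R} R-min))

δ₁-minimal : TMinimal 0 (δ 1)
δ₁-minimal = cutoff×punctured⇒minimal (record { needs = needs′ ; covers = covers′ })
  (λ p → 0 , 0 , z≤n , singletons-off (δ 1) p)
  where
  needs′ : CoverableOff r s (δ 1) ∅ → 0 < r + s
  needs′ {r} {s} cv with proj₁ (coverableOff⇒coverable cv λ _ ()) zero
  ... | inj₁ a = ℕ.<-≤-trans (ℕ.≤-<-trans z≤n (Fin.toℕ<n a)) (ℕ.m≤m+n r s)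
  ... | inj₂ b = ℕ.<-≤-trans (ℕ.≤-<-trans z≤n (Fin.toℕ<n b)) (ℕ.m≤n+m s r)
  covers′ : ∀ r s → 0 < r + s → CoverableOff r s (δ 1) ∅
  covers′ (suc r) s    _ = coverableOff-mono (s≤s z≤n) z≤n (coverable⇒coverableOff (singletons (δ 1)))
  covers′ zero (suc s) _ = coverableOff-mono ℕ.≤-refl (s≤s z≤n) δ-decreasing

minimal-exists : ∀ k → ∃ λ n → Σ (Perm n) (TMinimal k)
minimal-exists zero    = 1 , δ 1 , δ₁-minimal
minimal-exists (suc k) with minimal-exists k
... | _ , π , π-min = _ , π ⊕ δ (suc (suc k)) , ⊕δ-minimal {π = π} π-min

≤M-witness : ∀ {x} → x ≤M k → ∃ λ n → x ≤ n × Σ (Perm n) (TMinimal k)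
≤M-witness {k} (inj₁ refl) with minimal-exists k
... | n , π , π-min = n , z≤n , π , π-min
≤M-witness (inj₂ witness) = witness

M-suc-bound : ∀ k a → a ≤M k → (a + (k + 2)) ≤M (k + 1)
M-suc-bound k a a≤Mk with ≤M-witness a≤Mk
... | n , a≤n , π , π-min = inj₂ (n + suc (suc k) , ℕ.+-mono-≤ a≤n (ℕ.≤-reflexive (ℕ.+-comm k 2)) ,
  π ⊕ δ (suc (suc k)) , subst (λ k′ → TMinimal k′ (π ⊕ δ (suc (suc k)))) (ℕ.+-comm 1 k) (⊕δ-minimal {π = π} π-min))

M-even-bound : ∀ k a b → a ≤M k → b ≤M (k + 1) → (3 * a + b) ≤M (2 * k + 2)
M-even-bound k a b a≤Mk b≤Mk+1 with ≤M-witness a≤Mk | ≤M-witness b≤Mk+1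
... | nA , a≤nA , A , A-min | nR , b≤nR , R , R-min = inj₂ ((nA + nA) + (nA + nR) , length ,
  (A ⊕ A) ⊖ (A ⊕ R) , subst (λ k′ → TMinimal k′ ((A ⊕ A) ⊖ (A ⊕ R))) level
    (quad₂-minimal {A = A} {R = R} A-min (subst (λ k′ → TMinimal k′ R) (ℕ.+-comm k 1) R-min)))
  where
  open ≤-Reasoning
  level : suc (suc (k + k)) ≡ 2 * k + 2
  level = solve (k ∷ [])
  length : 3 * a + b ≤ (nA + nA) + (nA + nR)
  length = begin
    3 * a + b             ≡⟨ solve (a ∷ b ∷ []) ⟩
    (a + a) + (a + b)     ≤⟨ ℕ.+-mono-≤ (ℕ.+-mono-≤ a≤nA a≤nA) (ℕ.+-mono-≤ a≤nA b≤nR) ⟩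
    (nA + nA) + (nA + nR) ∎

M-odd-bound : ∀ k a b → a ≤M k → b ≤M (k + 1) → (a + 3 * b) ≤M (2 * k + 3)
M-odd-bound k a b a≤Mk b≤Mk+1 with ≤M-witness a≤Mk | ≤M-witness b≤Mk+1
... | nA , a≤nA , A , A-min | nR , b≤nR , R , R-min = inj₂ ((nA + nR) + (nR + nR) , length ,
  (A ⊕ R) ⊖ (R ⊕ R) , subst (λ k′ → TMinimal k′ ((A ⊕ R) ⊖ (R ⊕ R))) level
    (quad₃-minimal {A = A} {R = R} A-min (subst (λ k′ → TMinimal k′ R) (ℕ.+-comm k 1) R-min)))
  where
  open ≤-Reasoning
  level : suc (suc (suc (k + k))) ≡ 2 * k + 3
  level = solve (k ∷ [])
  length : a + 3 * b ≤ (nA + nR) + (nR + nR)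
  length = begin
    a + 3 * b             ≡⟨ solve (a ∷ b ∷ []) ⟩
    (a + b) + (b + b)     ≤⟨ ℕ.+-mono-≤ (ℕ.+-mono-≤ a≤nA b≤nR) (ℕ.+-mono-≤ b≤nR b≤nR) ⟩
    (nA + nR) + (nR + nR) ∎

lemma6 : (k : ℕ) →
    (∀ a → a ≤M k → (a + (k + 2)) ≤M (k + 1)) ×
    (∀ a b → a ≤M k → b ≤M (k + 1) → (3 * a + b) ≤M (2 * k + 2)) ×
    (∀ a b → a ≤M k → b ≤M (k + 1) → (a + 3 * b) ≤M (2 * k + 3))
lemma6 k = M-suc-bound k , M-even-bound k , M-odd-bound k
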